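{- For every integer $h\ge1$, the map \[G:\mathrm{t}\mapsto\big(\mathrm{t}^{\mathrm{fix}},\mathrm{t}^{\mathrm{free}},((v_j(\mathrm{t}),\mathrm{t}^{\mathrm{spn}}_j);1\le j\le\ell(\mathrm{t}))\big)\] is a bijection from $\mathcal{B}_h$ onto \[\mathcal{B}_h':=\mathcal{B}_{\lceil h/2\rceil-1}\times\bigcup_{k=\lfloor h/2\rfloor}^{h-1}\mathcal{B}_k\times\bigcup_{\ell\ge0}\Big(\big(\{1\}\times\bigcup_{k=0}^{\lceil h/2\rceil-1}\mathcal{B}_k\big)\cup\big(\{2\}\times\bigcup_{k=0}^{\lfloor h/2\rfloor-1}\mathcal{B}_k\big)\Big)^\ell.\]
   Context: Let $\mathcal{U}=\{1,2\}^*$ be the set of finite words over $\{1,2\}$ (including the empty word $\emptyset$); $uv$ denotes concatenation, $uV=\{uv:v\in V\}$. A binary tree is a finite set $\mathrm{t}\subset\mathcal{U}$ containing $\emptyset$ and closed under taking prefixes; it is full if for all $u\in\mathrm{t}$, $u1\in\mathrm{t}\iff u2\in\mathrm{t}$. For $u\in\mathrm{t}$, $\theta_u\mathrm{t}=\{v:uv\in\mathrm{t}\}$. Let $\preceq_{\mathrm{lex}}$ be the lexicographic order on $\mathcal{U}$ and $u\wedge v$ the longest common prefix. An embedding of $\mathrm{t}$ in $\mathrm{t}'$ is an injective map $\varphi:\mathrm{t}\to\mathrm{t}'$, strictly increasing for $\preceq_{\mathrm{lex}}$, with $\varphi(u\wedge v)=\varphi(u)\wedge\varphi(v)$. Define $\tau_0=\{\emptyset\}$,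 $\tau_1=\{\emptyset,1,2\}$, and for $m\ge1$: $\tau_{2m}=\{\emptyset\}\cup 1\tau_m\cup 2\tau_{m-1}$, $\tau_{2m+1}=\{\emptyset\}\cup 1\tau_m\cup 2\tau_m$. The refined Horton--Strahler number is $\mathcal{S}(\mathrm{t})=\max\{r:\tau_r\text{ embeds in }\mathrm{t}\}$, $\mathcal{S}_u(\mathrm{t})=\mathcal{S}(\theta_u\mathrm{t})$. $\mathcal{B}_h$ denotes the set of all full binary trees $\mathrm{t}$ with $\mathcal{S}(\mathrm{t})=h$. For a full binary tree $\mathrm{t}$ with $\mathcal{S}(\mathrm{t})\ge1$: $u(\mathrm{t})$ is the $\preceq_{\mathrm{lex}}$-maximal vertex $u\in\mathrm{t}$ with $\mathcal{S}_u(\mathrm{t})=\mathcal{S}(\mathrm{t})$ (it is internal); $\ell(\mathrm{t})=|u|$, $u=u_1\dots u_\ell$; for $1\le j\le\ell$, $v_j(\mathrm{t})=3-u_j$ and $\mathrm{t}^{\mathrm{spn}}_j=\theta_{u_1\dots u_{j-1}v_j}\mathrm{t}$; $\mathrm{t}^{\mathrm{free}}=\theta_{u1}\mathrm{t}$, $\mathrm{t}^{\mathrm{fix}}=\theta_{u2}\mathrm{t}$ if $\mathcal{S}(\mathrm{t})$ is even, and $\mathrm{t}^{\mathrm{free}}=\theta_{u2}\mathrm{t}$, $\mathrm{t}^{\mathrm{fix}}=\theta_{u1}\mathrm{t}$ if $\mathcal{S}(\mathrm{t})$ is odd. In the product, the index $\ell$ ranges over integers $\ge0$ and $X^0$ is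 the one-element set containing the empty sequence. -}

module Defs where

open import Data.Nat using (ℕ; zero; suc; _≤_; _<_; _∸_; ⌊_/2⌋; ⌈_/2⌉; _≟_)
open import Data.Bool using (Bool; true; false; if_then_else_)
open import Data.List using (List; []; _∷_; [_]; _++_; map; filter; foldl)
open import Data.Product using (Σ; ∃; _×_; _,_)
open import Relation.Nullary using (¬_; Dec; yes; no; does)
open import Relation.Binary.PropositionalEquality using (_≡_; refl)

data Dir : Set where
  one two : Dir

Word : Set
Word = List Dir

-- v_j = 3 - u_j
flip : Dir → Dir
flip one = two
flip two = one

data _<lex_ : Word → Word → Set where
  nil<cons : ∀ {a v} → [] <lex (a ∷ v)
  one<two  : ∀ {u v} → (one ∷ u) <lex (two ∷ v)
  step     : ∀ {a u v} → u <lex v → (a ∷ u) <lex (a ∷ v)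

_<ᵇ_ : Word → Word → Bool
[] <ᵇ [] = false
[] <ᵇ (_ ∷ _) = true
(_ ∷ _) <ᵇ [] = false
(one ∷ u) <ᵇ (one ∷ v) = u <ᵇ v
(one ∷ u) <ᵇ (two ∷ v) = true
(two ∷ u) <ᵇ (one ∷ v) = false
(two ∷ u) <ᵇ (two ∷ v) = u <ᵇ v

_∧_ : Word → Word → Word
[] ∧ _ = []
(_ ∷ _) ∧ [] = []
(one ∷ u) ∧ (one ∷ v) = one ∷ (u ∧ v)
(two ∷ u) ∧ (two ∷ v) = two ∷ (u ∧ v)
(one ∷ u) ∧ (two ∷ v) = []
(two ∷ u) ∧ (one ∷ v) = []

-- Full binary trees.  A full binary tree t ⊂ U is represented by the
-- inductive tree whose vertex set (as words) is t.

data Tree : Set where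
  leaf : Tree
  node : Tree → Tree → Tree

data _∈T_ : Word → Tree → Set where
  root  : ∀ {t} → [] ∈T t
  left  : ∀ {u l r} → u ∈T l → (one ∷ u) ∈T node l r
  right : ∀ {u l r} → u ∈T r → (two ∷ u) ∈T node l r

-- θ_u t  (only meaningful for u ∈ t; returns leaf otherwise)
θ : Word → Tree → Tree
θ [] t = t
θ (one ∷ u) (node l r) = θ u l
θ (two ∷ u) (node l r) = θ u r
θ (_ ∷ _) leaf = leaf

vertices : Tree → List Word
vertices leaf = [ [] ]
vertices (node l r) = [] ∷ (map (one ∷_) (vertices l) ++ map (two ∷_) (vertices r))

Embeds : Tree → Tree → Set
Embeds t t' = Σ (Word → Word) λ φ →
    (∀ u → u ∈T t → φ u ∈T t')
  × (∀ u v → u ∈T t → v ∈T t → φ u ≡ φ v → u ≡ v)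
  × (∀ u v → u ∈T t → v ∈T t → u <lex v → φ u <lex φ v)
  × (∀ u v → u ∈T t → v ∈T t → φ (u ∧ v) ≡ (φ u ∧ φ v))

isEven : ℕ → Bool
isEven zero = true
isEven (suc zero) = false
isEven (suc (suc n)) = isEven n

-- τ with fuel (fuel ≥ n suffices)
τf : ℕ → ℕ → Tree
τf zero _ = leaf
τf (suc f) zero = leaf
τf (suc f) (suc zero) = node leaf leaf
τf (suc f) (suc (suc n)) =
  let m = ⌊ suc (suc n) /2⌋ in
  if isEven n then node (τf f m) (τf f (m ∸ 1))
              else node (τf f m) (τf f m)

τ : ℕ → Tree
τ n = τf n n

IsHS : Tree → ℕ → Set
IsHS t h = Embeds (τ h) t × (∀ r → Embeds (τ r) t → r ≤ h)

B : ℕ → Tree → Set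
B h t = IsHS t h

-- The map G, relative to a function S : Tree → ℕ
-- (the theorem assumes S t is the refined Horton–Strahler number of t).

module _ (S : Tree → ℕ) where

  maxLex : Word → Word → Word
  maxLex a b = if a <ᵇ b then b else a

  uT : Tree → Word
  uT t = foldl maxLex [] (filter (λ u → S (θ u t) ≟ S t) (vertices t))

  -- ((v_j, t^spn_j) ; 1 ≤ j ≤ ℓ), with p = u_1 … u_{j-1}
  spineL : Tree → Word → Word → List (Dir × Tree)
  spineL t p [] = []
  spineL t p (a ∷ u) = (flip a , θ (p ++ [ flip a ]) t) ∷ spineL t (p ++ [ a ]) u

  tFree : Tree → Tree
  tFree t = if isEven (S t) then θ (uT t ++ [ one ]) t else θ (uT t ++ [ two ]) t

  tFix : Tree → Tree
  tFix t = if isEven (S t) then θ (uT t ++ [ two ]) t else θ (uT t ++ [ one ]) t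

  G : Tree → Tree × Tree × List (Dir × Tree)
  G t = tFix t , tFree t , spineL t [] (uT t)

SpineOK : ℕ → Dir × Tree → Set
SpineOK h (one , s) = ∃ λ k → k < ⌈ h /2⌉ × B k s
SpineOK h (two , s) = ∃ λ k → k < ⌊ h /2⌋ × B k s

data AllSpine (h : ℕ) : List (Dir × Tree) → Set where
  []  : AllSpine h []
  _∷_ : ∀ {x xs} → SpineOK h x → AllSpine h xs → AllSpine h (x ∷ xs)

B′ : ℕ → Tree × Tree × List (Dir × Tree) → Set
B′ h (tfix , tfree , sp) =
    B (⌈ h /2⌉ ∸ 1) tfix
  × (∃ λ k → ⌊ h /2⌋ ≤ k × k < h × B k tfree)
  × AllSpine h sp

module Submission where

open import Defs
open import Data.Nat using (ℕ; zero; suc; _+_; _≤_; _<_; _≥_; _∸_; _⊔_; z≤n; s≤s; _≤′_; ≤′-refl; ≤′-step; ⌊_/2⌋; ⌈_/2⌉; _≟_; _≤?_)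
open import Data.Nat.Properties
open import Data.Nat.Induction using (<-rec)
open import Data.Bool using (true; false; if_then_else_)
open import Data.List using (List; []; _∷_; [_]; _++_; map; filter; foldl; drop)
open import Data.List.Properties using (∷-injectiveʳ)
open import Data.List.Membership.Propositional using (_∈_)
open import Data.List.Membership.Propositional.Properties using (∈-map⁺; ∈-map⁻; ∈-++⁺ˡ; ∈-++⁺ʳ; ∈-++⁻; ∈-filter⁺; ∈-filter⁻)
open import Data.List.Relation.Unary.All as All using (All; []; _∷_)
open import Data.List.Relation.Unary.Any using (here; there)
open import Data.Product using (∃; ∃₂; _×_; _,_; proj₁; proj₂)
open import Data.Sum using (_⊎_; inj₁; inj₂)
open import Data.Empty using (⊥; ⊥-elim)
open import Function using (_∘_)
open import Relation.Nullary using (¬_; Dec; yes; no)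
open import Relation.Binary.PropositionalEquality hiding ([_])
open ≡-Reasoning

-- An embedding of τ (suc n) into a node either lies in one child or splits at the root, so
-- S (node l r) = nodeHS (S l) (S r). As nodeHS a b ≥ a, b and nodeHS h h > h, at most one
-- child of a vertex of number h keeps h: the vertices of number S t form a path from the
-- root ending at u(t), and S stays h along it exactly when the siblings are small
-- (< ⌈h/2⌉ on the left, < ⌊h/2⌋ on the right). At u(t) both children drop below h, which
-- by the formula for nodeHS pins their numbers down to ⌈h/2⌉ - 1 and [⌊h/2⌋, h).
-- Hence G cuts t into pieces of the prescribed kinds, and grafting such pieces back
-- along the path (rebuild) inverts it.

m<⌊n/2⌋⇒2+m+m≤n : ∀ m n → m < ⌊ n /2⌋ → suc (suc (m + m)) ≤ n
m<⌊n/2⌋⇒2+m+m≤n zero    (suc (suc n)) _       = s≤s (s≤s z≤n)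
m<⌊n/2⌋⇒2+m+m≤n (suc m) (suc (suc n)) (s≤s p) =
  s≤s (s≤s (subst (_≤ n) (cong suc (sym (+-suc m m))) (m<⌊n/2⌋⇒2+m+m≤n m n p)))

2+m+m≤n⇒m<⌊n/2⌋ : ∀ m n → suc (suc (m + m)) ≤ n → m < ⌊ n /2⌋
2+m+m≤n⇒m<⌊n/2⌋ m n p = subst (λ k → suc k ≤ ⌊ n /2⌋) (sym (n≡⌊n+n/2⌋ m)) (⌊n/2⌋-mono p)

-- ⌈ n /2⌉ is ⌊ suc n /2⌋ by definition.
m<⌈n/2⌉⇒1+m+m≤n : ∀ m n → m < ⌈ n /2⌉ → suc (m + m) ≤ n
m<⌈n/2⌉⇒1+m+m≤n m n p = ≤-pred (m<⌊n/2⌋⇒2+m+m≤n m (suc n) p)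

1+m+m≤n⇒m<⌈n/2⌉ : ∀ m n → suc (m + m) ≤ n → m < ⌈ n /2⌉
1+m+m≤n⇒m<⌈n/2⌉ m n p = 2+m+m≤n⇒m<⌊n/2⌋ m (suc n) (s≤s p)

data OddOrEven : ℕ → Set where
  odd  : ∀ m → OddOrEven (suc (m + m))
  even : ∀ m → OddOrEven (suc (suc (m + m)))

oddOrEven : ∀ n → OddOrEven (suc n)
oddOrEven zero = odd zero
oddOrEven (suc n) with oddOrEven n
... | odd m  = even m
... | even m = subst OddOrEven (cong (suc ∘ suc) (+-suc m m)) (odd (suc m))

isEven-double : ∀ m → isEven (m + m) ≡ true
isEven-double zero    = refl
isEven-double (suc m) rewrite +-suc m m = isEven-double m

isEven-odd : ∀ m → isEven (suc (m + m)) ≡ false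
isEven-odd zero    = refl
isEven-odd (suc m) rewrite +-suc m m = isEven-odd m

odd-halves : ∀ m → ⌈ suc (m + m) /2⌉ ∸ 1 ≡ m × ⌊ suc (m + m) /2⌋ ≡ m
odd-halves m = sym (n≡⌊n+n/2⌋ m) , sym (n≡⌈n+n/2⌉ m)

even-halves : ∀ m → ⌈ suc (suc (m + m)) /2⌉ ∸ 1 ≡ m × ⌊ suc (suc (m + m)) /2⌋ ≡ suc m
even-halves m = sym (n≡⌈n+n/2⌉ m) , cong suc (sym (n≡⌊n+n/2⌋ m))

-- The number of a node with children of numbers a and b: the larger of a, b, and the largest
-- τ (2m+1) = node (τ m) (τ m) or τ (2m+2) = node (τ (m+1)) (τ m) fitting across the root.
nodeHS : ℕ → ℕ → ℕ
nodeHS a b with a ≤? b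
... | yes _ = b ⊔ suc (a + a)
... | no _  = a ⊔ suc (suc (b + b))

nodeHS-≥ˡ : ∀ a b → a ≤ nodeHS a b
nodeHS-≥ˡ a b with a ≤? b
... | yes a≤b = ≤-trans a≤b (m≤m⊔n b _)
... | no _    = m≤m⊔n a _

nodeHS-≥ʳ : ∀ a b → b ≤ nodeHS a b
nodeHS-≥ʳ a b with a ≤? b
... | yes _   = m≤m⊔n b _
... | no a≰b  = ≤-trans (<⇒≤ (≰⇒> a≰b)) (m≤m⊔n a _)

nodeHS-≥-odd : ∀ {m a b} → m ≤ a → m ≤ b → suc (m + m) ≤ nodeHS a b
nodeHS-≥-odd {m} {a} {b} m≤a m≤b with a ≤? b
... | yes _ = ≤-trans (s≤s (+-mono-≤ m≤a m≤a)) (m≤n⊔m b _)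
... | no _  = ≤-trans (m≤n⇒m≤1+n (s≤s (+-mono-≤ m≤b m≤b))) (m≤n⊔m a _)

nodeHS-≥-even : ∀ {m a b} → suc m ≤ a → m ≤ b → suc (suc (m + m)) ≤ nodeHS a b
nodeHS-≥-even {m} {a} {b} m<a m≤b with a ≤? b
... | yes _ = ≤-trans (subst (_≤ suc (a + a)) (cong suc (+-suc m m)) (m≤n⇒m≤1+n (+-mono-≤ m<a m<a))) (m≤n⊔m b _)
... | no _  = ≤-trans (s≤s (s≤s (+-mono-≤ m≤b m≤b))) (m≤n⊔m a _)

nodeHS-smallˡ : ∀ a h → a < ⌈ h /2⌉ → nodeHS a h ≡ h
nodeHS-smallˡ a h a<h/2 with a ≤? h
... | yes _   = m≥n⇒m⊔n≡m (m<⌈n/2⌉⇒1+m+m≤n a h a<h/2)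
... | no a≰h  = ⊥-elim (a≰h (≤-trans (m≤n+m a (suc a)) (m<⌈n/2⌉⇒1+m+m≤n a h a<h/2)))

nodeHS-smallˡ⁻¹ : ∀ a h → nodeHS a h ≡ h → a < ⌈ h /2⌉
nodeHS-smallˡ⁻¹ a h e with a ≤? h
... | yes _   = 1+m+m≤n⇒m<⌈n/2⌉ a h (subst (suc (a + a) ≤_) e (m≤n⊔m h _))
... | no a≰h  = ⊥-elim (a≰h (subst (a ≤_) e (m≤m⊔n a _)))

nodeHS-smallʳ : ∀ h b → b < ⌊ h /2⌋ → nodeHS h b ≡ h
nodeHS-smallʳ h b b<h/2 with h ≤? b
... | yes h≤b = ⊥-elim (<⇒≱ (<-≤-trans b<h/2 (⌊n/2⌋≤n h)) h≤b)
... | no _    = m≥n⇒m⊔n≡m (m<⌊n/2⌋⇒2+m+m≤n b h b<h/2)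

nodeHS-smallʳ⁻¹ : ∀ h b → nodeHS h b ≡ h → b < h → b < ⌊ h /2⌋
nodeHS-smallʳ⁻¹ h b e b<h with h ≤? b
... | yes h≤b = ⊥-elim (<⇒≱ b<h h≤b)
... | no _    = 2+m+m≤n⇒m<⌊n/2⌋ b h (subst (suc (suc (b + b)) ≤_) e (m≤n⊔m h _))

nodeHS-children< : ∀ a b h → nodeHS a b ≡ h → a < h → b < h →
  (h ≡ suc (a + a) × a ≤ b) ⊎ (h ≡ suc (suc (b + b)) × b < a)
nodeHS-children< a b h e a<h b<h with a ≤? b
... | yes a≤b with ⊔-sel b (suc (a + a))
...   | inj₁ e′ = ⊥-elim (<-irrefl (trans (sym e′) e) b<h)
...   | inj₂ e′ = inj₁ (trans (sym e) e′ , a≤b)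
nodeHS-children< a b h e a<h b<h | no a≰b with ⊔-sel a (suc (suc (b + b)))
...   | inj₁ e′ = ⊥-elim (<-irrefl (trans (sym e′) e) a<h)
...   | inj₂ e′ = inj₂ (trans (sym e) e′ , ≰⇒> a≰b)

nodeHS-odd : ∀ m k → m ≤ k → k < suc (m + m) → nodeHS m k ≡ suc (m + m)
nodeHS-odd m k m≤k k<h with m ≤? k
... | yes _   = m≤n⇒m⊔n≡n (<⇒≤ k<h)
... | no m≰k  = ⊥-elim (m≰k m≤k)

nodeHS-even : ∀ m k → m < k → k < suc (suc (m + m)) → nodeHS k m ≡ suc (suc (m + m))
nodeHS-even m k m<k k<h with k ≤? m
... | yes k≤m = ⊥-elim (<⇒≱ m<k k≤m)
... | no _    = m≤n⇒m⊔n≡n (<⇒≤ k<h)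

τf-stable : ∀ f g n → n ≤ f → n ≤ g → τf f n ≡ τf g n
τf-stable zero    zero    zero _ _ = refl
τf-stable zero    (suc g) zero _ _ = refl
τf-stable (suc f) zero    zero _ _ = refl
τf-stable (suc f) (suc g) zero _ _ = refl
τf-stable (suc f) (suc g) (suc zero) _ _ = refl
τf-stable (suc f) (suc g) (suc (suc k)) (s≤s k<f) (s≤s k<g)
  = cong₂ (λ x y → if isEven k then node x y else node x x)
          (stable-at (suc ⌊ k /2⌋) (s≤s (⌊n/2⌋≤n k)))
          (stable-at ⌊ k /2⌋ (m≤n⇒m≤1+n (⌊n/2⌋≤n k)))
  where
  stable-at : ∀ n → n ≤ suc k → τf f n ≡ τf g n
  stable-at n n≤k = τf-stable f g n (≤-trans n≤k k<f) (≤-trans n≤k k<g)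

τf≡τ : ∀ f n → n ≤ f → τf f n ≡ τ n
τf≡τ f n n≤f = τf-stable f n n n≤f ≤-refl

τ-odd : ∀ m → τ (suc (m + m)) ≡ node (τ m) (τ m)
τ-odd zero = refl
τ-odd (suc m) rewrite +-suc m m | isEven-odd m | proj₂ (odd-halves m) =
  cong₂ node τ-suc τ-suc
  where
  τ-suc : τf (suc (suc (m + m))) (suc m) ≡ τ (suc m)
  τ-suc = τf≡τ _ (suc m) (s≤s (m≤n⇒m≤1+n (m≤m+n m m)))

τ-even : ∀ m → τ (suc (suc (m + m))) ≡ node (τ (suc m)) (τ m)
τ-even m rewrite isEven-double m | sym (n≡⌊n+n/2⌋ m) =
  cong₂ node (τf≡τ _ (suc m) (s≤s (m≤m+n m m))) (τf≡τ _ m (m≤n⇒m≤1+n (m≤m+n m m)))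

τ-suc-node : ∀ n → ∃₂ λ A B → τ (suc n) ≡ node A B
τ-suc-node n with oddOrEven n
... | odd m  = _ , _ , τ-odd m
... | even m = _ , _ , τ-even m

emb-refl : ∀ {t} → Embeds t t
emb-refl = (λ u → u) , (λ _ u∈ → u∈) , (λ _ _ _ _ e → e) , (λ _ _ _ _ u<v → u<v) , (λ _ _ _ _ → refl)

emb-trans : ∀ {a b c} → Embeds a b → Embeds b c → Embeds a c
emb-trans (φ , φ∈ , φ-inj , φ-lex , φ-∧) (ψ , ψ∈ , ψ-inj , ψ-lex , ψ-∧) =
  ψ ∘ φ ,
  (λ u u∈ → ψ∈ _ (φ∈ u u∈)) ,
  (λ u v u∈ v∈ e → φ-inj u v u∈ v∈ (ψ-inj _ _ (φ∈ u u∈) (φ∈ v v∈) e)) ,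
  (λ u v u∈ v∈ u<v → ψ-lex _ _ (φ∈ u u∈) (φ∈ v v∈) (φ-lex u v u∈ v∈ u<v)) ,
  (λ u v u∈ v∈ → trans (cong ψ (φ-∧ u v u∈ v∈)) (ψ-∧ _ _ (φ∈ u u∈) (φ∈ v v∈)))

emb-leaf : ∀ {t} → Embeds leaf t
emb-leaf = (λ _ → []) , (λ _ _ → root) , (λ { _ _ root root _ → refl }) , (λ { _ _ root root () }) , (λ _ _ _ _ → refl)

∧-cons : ∀ d x y → (d ∷ x) ∧ (d ∷ y) ≡ d ∷ (x ∧ y)
∧-cons one x y = refl
∧-cons two x y = refl

emb-under : ∀ d {A l r} → Embeds A (θ [ d ] (node l r)) → Embeds A (node l r)
emb-under d (φ , φ∈ , φ-inj , φ-lex , φ-∧) =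
  (d ∷_) ∘ φ ,
  (λ u u∈ → under∈ d (φ∈ u u∈)) ,
  (λ u v u∈ v∈ e → φ-inj u v u∈ v∈ (∷-injectiveʳ e)) ,
  (λ u v u∈ v∈ u<v → step (φ-lex u v u∈ v∈ u<v)) ,
  (λ u v u∈ v∈ → trans (cong (d ∷_) (φ-∧ u v u∈ v∈)) (sym (∧-cons d (φ u) (φ v))))
  where
  under∈ : ∀ d {w l r} → w ∈T θ [ d ] (node l r) → (d ∷ w) ∈T node l r
  under∈ one = left
  under∈ two = right

module _ {A B l r : Tree} (E₁ : Embeds A l) (E₂ : Embeds B r) where
  private
    φ₁ = proj₁ E₁
    φ₂ = proj₁ E₂

  nodeφ : Word → Word
  nodeφ []        = []
  nodeφ (one ∷ u) = one ∷ φ₁ u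
  nodeφ (two ∷ u) = two ∷ φ₂ u

  nodeφ∈ : ∀ u → u ∈T node A B → nodeφ u ∈T node l r
  nodeφ∈ _ root      = root
  nodeφ∈ _ (left p)  = left (proj₁ (proj₂ E₁) _ p)
  nodeφ∈ _ (right p) = right (proj₁ (proj₂ E₂) _ p)

  nodeφ-inj : ∀ u v → u ∈T node A B → v ∈T node A B → nodeφ u ≡ nodeφ v → u ≡ v
  nodeφ-inj _ _ root      root      _ = refl
  nodeφ-inj _ _ (left p)  (left q)  e = cong (one ∷_) (proj₁ (proj₂ (proj₂ E₁)) _ _ p q (∷-injectiveʳ e))
  nodeφ-inj _ _ (right p) (right q) e = cong (two ∷_) (proj₁ (proj₂ (proj₂ E₂)) _ _ p q (∷-injectiveʳ e))
  nodeφ-inj _ _ root      (left _)  ()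
  nodeφ-inj _ _ root      (right _) ()
  nodeφ-inj _ _ (left _)  root      ()
  nodeφ-inj _ _ (right _) root      ()
  nodeφ-inj _ _ (left _)  (right _) ()
  nodeφ-inj _ _ (right _) (left _)  ()

  nodeφ-lex : ∀ u v → u ∈T node A B → v ∈T node A B → u <lex v → nodeφ u <lex nodeφ v
  nodeφ-lex _ _ root      (left _)  nil<cons  = nil<cons
  nodeφ-lex _ _ root      (right _) nil<cons  = nil<cons
  nodeφ-lex _ _ (left _)  (right _) one<two   = one<two
  nodeφ-lex _ _ (left p)  (left q)  (step lt) = step (proj₁ (proj₂ (proj₂ (proj₂ E₁))) _ _ p q lt)
  nodeφ-lex _ _ (right p) (right q) (step lt) = step (proj₁ (proj₂ (proj₂ (proj₂ E₂))) _ _ p q lt)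

  nodeφ-∧ : ∀ u v → u ∈T node A B → v ∈T node A B → nodeφ (u ∧ v) ≡ (nodeφ u ∧ nodeφ v)
  nodeφ-∧ _ _ root      _         = refl
  nodeφ-∧ _ _ (left _)  root      = refl
  nodeφ-∧ _ _ (right _) root      = refl
  nodeφ-∧ _ _ (left p)  (left q)  = cong (one ∷_) (proj₂ (proj₂ (proj₂ (proj₂ E₁))) _ _ p q)
  nodeφ-∧ _ _ (right p) (right q) = cong (two ∷_) (proj₂ (proj₂ (proj₂ (proj₂ E₂))) _ _ p q)
  nodeφ-∧ _ _ (left _)  (right _) = refl
  nodeφ-∧ _ _ (right _) (left _)  = refl

  emb-node : Embeds (node A B) (node l r)
  emb-node = nodeφ , nodeφ∈ , nodeφ-inj , nodeφ-lex , nodeφ-∧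

emb-child : ∀ d {A B X} → Embeds (node A B) X → Embeds (θ [ d ] (node A B)) X
emb-child d (φ , φ∈ , φ-inj , φ-lex , φ-∧) =
  φ ∘ (d ∷_) ,
  (λ u u∈ → φ∈ _ (child∈ d u∈)) ,
  (λ u v u∈ v∈ e → ∷-injectiveʳ (φ-inj _ _ (child∈ d u∈) (child∈ d v∈) e)) ,
  (λ u v u∈ v∈ u<v → φ-lex _ _ (child∈ d u∈) (child∈ d v∈) (step u<v)) ,
  (λ u v u∈ v∈ → trans (cong φ (sym (∧-cons d u v))) (φ-∧ _ _ (child∈ d u∈) (child∈ d v∈)))
  where
  child∈ : ∀ d {w A B} → w ∈T θ [ d ] (node A B) → (d ∷ w) ∈T node A B
  child∈ one = left
  child∈ two = right

emb-below-root : ∀ {T X d w} (E : Embeds T X) → proj₁ E [] ≡ d ∷ w →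
  ∀ u → u ∈T T → ∃ λ z → proj₁ E u ≡ d ∷ z
emb-below-root {d = d} {w} (φ , _ , _ , _ , φ-∧) root≡ u u∈ =
  prefix d (φ u) w (begin
    d ∷ w         ≡⟨ sym root≡ ⟩
    φ []          ≡⟨ cong φ (sym (∧-[] u)) ⟩
    φ (u ∧ [])    ≡⟨ φ-∧ u [] u∈ root ⟩
    φ u ∧ φ []    ≡⟨ cong (φ u ∧_) root≡ ⟩
    φ u ∧ (d ∷ w) ∎)
  where
  ∧-[] : ∀ u → u ∧ [] ≡ []
  ∧-[] []      = refl
  ∧-[] (_ ∷ _) = refl
  prefix : ∀ d x w → d ∷ w ≡ x ∧ (d ∷ w) → ∃ λ z → x ≡ d ∷ z
  prefix one (one ∷ z) _ _ = z , refl
  prefix two (two ∷ z) _ _ = z , refl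
  prefix one []        _ ()
  prefix two []        _ ()
  prefix one (two ∷ _) _ ()
  prefix two (one ∷ _) _ ()

emb-restrict : ∀ {T l r d w} (E : Embeds T (node l r)) → proj₁ E [] ≡ d ∷ w → Embeds T (θ [ d ] (node l r))
emb-restrict {T} {l} {r} {d} E@(φ , φ∈ , φ-inj , φ-lex , φ-∧) root≡ = drop 1 ∘ φ , ψ∈ , ψ-inj , ψ-lex , ψ-∧
  where
  below : ∀ u → u ∈T T → ∃ λ z → φ u ≡ d ∷ z
  below = emb-below-root E root≡
  ψ∈ : ∀ u → u ∈T T → drop 1 (φ u) ∈T θ [ d ] (node l r)
  ψ∈ u u∈ with below u u∈ | φ∈ u u∈
  ... | z , e | φu∈ rewrite e = under d φu∈
    where
    under : ∀ d {z} → (d ∷ z) ∈T node l r → z ∈T θ [ d ] (node l r)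
    under one (left p)  = p
    under two (right p) = p
  ψ-inj : ∀ u v → u ∈T T → v ∈T T → drop 1 (φ u) ≡ drop 1 (φ v) → u ≡ v
  ψ-inj u v u∈ v∈ e with below u u∈ | below v v∈
  ... | z , eu | z′ , ev = φ-inj u v u∈ v∈ (begin
    φ u     ≡⟨ eu ⟩
    d ∷ z   ≡⟨ cong (d ∷_) (trans (cong (drop 1) (sym eu)) (trans e (cong (drop 1) ev))) ⟩
    d ∷ z′  ≡⟨ sym ev ⟩
    φ v     ∎)
  ψ-lex : ∀ u v → u ∈T T → v ∈T T → u <lex v → drop 1 (φ u) <lex drop 1 (φ v)
  ψ-lex u v u∈ v∈ u<v with below u u∈ | below v v∈ | φ-lex u v u∈ v∈ u<v
  ... | _ , eu | _ , ev | φu<φv rewrite eu | ev with φu<φv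
  ...   | step z<z′ = z<z′
  ψ-∧ : ∀ u v → u ∈T T → v ∈T T → drop 1 (φ (u ∧ v)) ≡ (drop 1 (φ u) ∧ drop 1 (φ v))
  ψ-∧ u v u∈ v∈ with below u u∈ | below v v∈ | φ-∧ u v u∈ v∈
  ... | z , eu | z′ , ev | φ∧ rewrite eu | ev | φ∧ = cong (drop 1) (∧-cons d z z′)

root-children-split : ∀ {x y} → [] <lex x → x <lex y → [] ≡ x ∧ y →
  (∃ λ x′ → x ≡ one ∷ x′) × (∃ λ y′ → y ≡ two ∷ y′)
root-children-split {one ∷ _} {two ∷ _} nil<cons one<two  _  = (_ , refl) , (_ , refl)
root-children-split {one ∷ _} {one ∷ _} nil<cons (step _) ()
root-children-split {two ∷ _} {two ∷ _} nil<cons (step _) ()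

emb-split : ∀ {A B l r} → Embeds (node A B) (node l r) →
  Embeds (node A B) l ⊎ Embeds (node A B) r ⊎ (Embeds A l × Embeds B r)
emb-split E@(φ , _ , _ , φ-lex , φ-∧) with φ [] in root≡
... | one ∷ _ = inj₁ (emb-restrict E root≡)
... | two ∷ _ = inj₂ (inj₁ (emb-restrict E root≡))
... | [] with root-children-split
                (subst (_<lex φ (one ∷ [])) root≡ (φ-lex [] (one ∷ []) root (left root) nil<cons))
                (φ-lex (one ∷ []) (two ∷ []) (left root) (right root) one<two)
                (trans (sym root≡) (φ-∧ (one ∷ []) (two ∷ []) (left root) (right root)))
...   | (_ , e₁) , (_ , e₂) = inj₂ (inj₂ (emb-restrict (emb-child one E) e₁ , emb-restrict (emb-child two E) e₂))

node↛leaf : ∀ {A B} → ¬ Embeds (node A B) leaf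
node↛leaf (φ , φ∈ , φ-inj , _ , _) with φ (one ∷ []) | φ∈ (one ∷ []) (left root) | φ (two ∷ []) | φ∈ (two ∷ []) (right root)
                                      | φ-inj (one ∷ []) (two ∷ []) (left root) (right root)
... | .[] | root | .[] | root | inj with inj refl
...   | ()

τ-step : ∀ n → Embeds (τ n) (τ (suc n))
τ-step = <-rec (λ n → Embeds (τ n) (τ (suc n))) grow
  where
  grow : ∀ n → (∀ {m} → m < n → Embeds (τ m) (τ (suc m))) → Embeds (τ n) (τ (suc n))
  grow zero    _   = emb-leaf
  grow (suc n) rec with oddOrEven n
  ... | odd m  = subst₂ Embeds (sym (τ-odd m)) (sym (τ-even m))
                   (emb-node (rec (s≤s (m≤m+n m m))) emb-refl)
  ... | even m = subst₂ Embeds (sym (τ-even m)) (sym (trans (cong (τ ∘ suc ∘ suc) (sym (+-suc m m))) (τ-odd (suc m))))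
                   (emb-node emb-refl (rec (s≤s (m≤n⇒m≤1+n (m≤m+n m m)))))

τ-mono : ∀ {m n} → m ≤ n → Embeds (τ m) (τ n)
τ-mono {m} m≤n = go (≤⇒≤′ m≤n)
  where
  go : ∀ {n} → m ≤′ n → Embeds (τ m) (τ n)
  go ≤′-refl                = emb-refl
  go {suc n} (≤′-step m≤n)  = emb-trans (go m≤n) (τ-step n)

emb-⊔ : ∀ {m n t} → Embeds (τ m) t → Embeds (τ n) t → Embeds (τ (m ⊔ n)) t
emb-⊔ {m} {n} {t} Em En with ⊔-sel m n
... | inj₁ e = subst (λ k → Embeds (τ k) t) (sym e) Em
... | inj₂ e = subst (λ k → Embeds (τ k) t) (sym e) En

isHS-unique : ∀ {t a b} → IsHS t a → IsHS t b → a ≡ b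
isHS-unique (Ea , a-max) (Eb , b-max) = ≤-antisym (b-max _ Ea) (a-max _ Eb)

isHS-leaf : IsHS leaf 0
isHS-leaf = emb-refl , bound
  where
  bound : ∀ r → Embeds (τ r) leaf → r ≤ 0
  bound zero    _ = z≤n
  bound (suc n) E with τ-suc-node n
  ... | _ , _ , e = ⊥-elim (node↛leaf (subst (λ T → Embeds T leaf) e E))

module _ {l r a b} (hl : IsHS l a) (hr : IsHS r b) where
  private
    El : Embeds (τ a) l
    El = proj₁ hl
    Er : Embeds (τ b) r
    Er = proj₁ hr
    a-max : ∀ n → Embeds (τ n) l → n ≤ a
    a-max = proj₂ hl
    b-max : ∀ n → Embeds (τ n) r → n ≤ b
    b-max = proj₂ hr

  τ-nodeHS-emb : Embeds (τ (nodeHS a b)) (node l r)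
  τ-nodeHS-emb with a ≤? b
  ... | yes a≤b = emb-⊔ {b} (emb-under two Er)
                    (subst (λ T → Embeds T (node l r)) (sym (τ-odd a)) (emb-node El (emb-trans (τ-mono a≤b) Er)))
  ... | no a≰b  = emb-⊔ {a} (emb-under one El)
                    (subst (λ T → Embeds T (node l r)) (sym (τ-even b)) (emb-node (emb-trans (τ-mono (≰⇒> a≰b)) El) Er))

  τ-node-bound : ∀ {n A B} → τ n ≡ node A B → (Embeds A l → Embeds B r → n ≤ nodeHS a b) →
    Embeds (τ n) (node l r) → n ≤ nodeHS a b
  τ-node-bound {n} e across E with emb-split (subst (λ T → Embeds T (node l r)) e E)
  ... | inj₁ E′         = ≤-trans (a-max n (subst (λ T → Embeds T l) (sym e) E′)) (nodeHS-≥ˡ a b)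
  ... | inj₂ (inj₁ E′)  = ≤-trans (b-max n (subst (λ T → Embeds T r) (sym e) E′)) (nodeHS-≥ʳ a b)
  ... | inj₂ (inj₂ (EA , EB)) = across EA EB

  isHS-node : IsHS (node l r) (nodeHS a b)
  isHS-node = τ-nodeHS-emb , bound
    where
    bound : ∀ n → Embeds (τ n) (node l r) → n ≤ nodeHS a b
    bound zero    _ = z≤n
    bound (suc n) with oddOrEven n
    ... | odd m  = τ-node-bound (τ-odd m) λ EA EB → nodeHS-≥-odd (a-max m EA) (b-max m EB)
    ... | even m = τ-node-bound (τ-even m) λ EA EB → nodeHS-≥-even (a-max (suc m) EA) (b-max m EB)

θ-leaf : ∀ u → θ u leaf ≡ leaf
θ-leaf []        = refl
θ-leaf (one ∷ _) = refl
θ-leaf (two ∷ _) = refl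

θ-++ : ∀ u v t → θ (u ++ v) t ≡ θ v (θ u t)
θ-++ []        v t          = refl
θ-++ (one ∷ u) v (node l r) = θ-++ u v l
θ-++ (two ∷ u) v (node l r) = θ-++ u v r
θ-++ (one ∷ u) v leaf       = sym (θ-leaf v)
θ-++ (two ∷ u) v leaf       = sym (θ-leaf v)

vertices-sound : ∀ t {x} → x ∈ vertices t → x ∈T t
vertices-sound leaf       (here refl) = root
vertices-sound (node l r) (here refl) = root
vertices-sound (node l r) (there x∈) with ∈-++⁻ (map (one ∷_) (vertices l)) x∈
... | inj₁ x∈l with ∈-map⁻ (one ∷_) x∈l
...   | _ , y∈ , refl = left (vertices-sound l y∈)
vertices-sound (node l r) (there x∈) | inj₂ x∈r with ∈-map⁻ (two ∷_) x∈r
...   | _ , y∈ , refl = right (vertices-sound r y∈)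

vertices-complete : ∀ t {x} → x ∈T t → x ∈ vertices t
vertices-complete leaf       root      = here refl
vertices-complete (node l r) root      = here refl
vertices-complete (node l r) (left p)  = there (∈-++⁺ˡ (∈-map⁺ (one ∷_) (vertices-complete l p)))
vertices-complete (node l r) (right p) = there (∈-++⁺ʳ (map (one ∷_) (vertices l)) (∈-map⁺ (two ∷_) (vertices-complete r p)))

nodeAt : Dir → Tree → Tree → Tree
nodeAt one x y = node x y
nodeAt two x y = node y x

θ-nodeAt : ∀ d x y → θ [ d ] (nodeAt d x y) ≡ x
θ-nodeAt one x y = refl
θ-nodeAt two x y = refl

θ-nodeAt-flip : ∀ d x y → θ [ flip d ] (nodeAt d x y) ≡ y
θ-nodeAt-flip one x y = refl
θ-nodeAt-flip two x y = refl

nodeAt-η : ∀ d L R → nodeAt d (θ [ d ] (node L R)) (θ [ flip d ] (node L R)) ≡ node L R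
nodeAt-η one L R = refl
nodeAt-η two L R = refl

spine : Tree → Word → List (Dir × Tree)
spine t []      = []
spine t (d ∷ u) = (flip d , θ [ flip d ] t) ∷ spine (θ [ d ] t) u

spineL≡spine : ∀ S t p u → spineL S t p u ≡ spine (θ p t) u
spineL≡spine S t p []      = refl
spineL≡spine S t p (d ∷ u) =
  cong₂ _∷_ (cong (flip d ,_) (θ-++ p [ flip d ] t))
            (trans (spineL≡spine S t (p ++ [ d ]) u) (cong (λ s → spine s u) (θ-++ p [ d ] t)))

graft : List (Dir × Tree) → Tree → Tree
graft []             c = c
graft ((d , s) ∷ sp) c = nodeAt d s (graft sp c)

dirs : List (Dir × Tree) → Word
dirs = map (flip ∘ proj₁)

graft-spine : ∀ {t u} → u ∈T t → graft (spine t u) (θ u t) ≡ t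
graft-spine root      = refl
graft-spine (left p)  = cong (λ x → node x _) (graft-spine p)
graft-spine (right p) = cong (node _) (graft-spine p)

θ-graft : ∀ sp c → θ (dirs sp) (graft sp c) ≡ c
θ-graft []              c = refl
θ-graft ((one , s) ∷ sp) c = θ-graft sp c
θ-graft ((two , s) ∷ sp) c = θ-graft sp c

spine-graft : ∀ sp c → spine (graft sp c) (dirs sp) ≡ sp
spine-graft []              c = refl
spine-graft ((one , s) ∷ sp) c = cong ((one , s) ∷_) (spine-graft sp c)
spine-graft ((two , s) ∷ sp) c = cong ((two , s) ∷_) (spine-graft sp c)

fixDir : ℕ → Dir
fixDir h = if isEven h then two else one

fixDir-odd : ∀ m → fixDir (suc (m + m)) ≡ one
fixDir-odd m = cong (λ b → if b then two else one) (isEven-odd m)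

fixDir-even : ∀ m → fixDir (suc (suc (m + m))) ≡ two
fixDir-even m = cong (λ b → if b then two else one) (isEven-double m)

G-unfold : ∀ S t {h u} → S t ≡ h → uT S t ≡ u →
  G S t ≡ (θ [ fixDir h ] (θ u t) , θ [ flip (fixDir h) ] (θ u t) , spine t u)
G-unfold S t refl refl with isEven (S t)
... | true  = cong₂ _,_ (θ-++ (uT S t) [ two ] t) (cong₂ _,_ (θ-++ (uT S t) [ one ] t) (spineL≡spine S t [] (uT S t)))
... | false = cong₂ _,_ (θ-++ (uT S t) [ one ] t) (cong₂ _,_ (θ-++ (uT S t) [ two ] t) (spineL≡spine S t [] (uT S t)))

rebuild : ℕ → Tree × Tree × List (Dir × Tree) → Tree
rebuild h (fix , free , sp) = graft sp (nodeAt (fixDir h) fix free)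

rebuild-G : ∀ S t {h u L R} → S t ≡ h → uT S t ≡ u → u ∈T t → θ u t ≡ node L R → rebuild h (G S t) ≡ t
rebuild-G S t {h} {u} {L} {R} St≡h uT≡u u∈t c≡ = begin
  rebuild h (G S t)
    ≡⟨ cong (rebuild h) (G-unfold S t St≡h uT≡u) ⟩
  graft (spine t u) (nodeAt d (θ [ d ] (θ u t)) (θ [ flip d ] (θ u t)))
    ≡⟨ cong (λ c → graft (spine t u) (nodeAt d (θ [ d ] c) (θ [ flip d ] c))) c≡ ⟩
  graft (spine t u) (nodeAt d (θ [ d ] (node L R)) (θ [ flip d ] (node L R)))
    ≡⟨ cong (graft (spine t u)) (trans (nodeAt-η d L R) (sym c≡)) ⟩
  graft (spine t u) (θ u t)
    ≡⟨ graft-spine u∈t ⟩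
  t ∎
  where
  d : Dir
  d = fixDir h

G-rebuild : ∀ S h fix free sp → S (rebuild h (fix , free , sp)) ≡ h → uT S (rebuild h (fix , free , sp)) ≡ dirs sp →
  G S (rebuild h (fix , free , sp)) ≡ (fix , free , sp)
G-rebuild S h fix free sp St≡h uT≡dirs = begin
  G S t
    ≡⟨ G-unfold S t St≡h uT≡dirs ⟩
  (θ [ d ] (θ (dirs sp) t) , θ [ flip d ] (θ (dirs sp) t) , spine t (dirs sp))
    ≡⟨ cong (λ c → θ [ d ] c , θ [ flip d ] c , spine t (dirs sp)) (θ-graft sp c) ⟩
  (θ [ d ] c , θ [ flip d ] c , spine t (dirs sp))
    ≡⟨ cong₂ _,_ (θ-nodeAt d fix free) (cong₂ _,_ (θ-nodeAt-flip d fix free) (spine-graft sp c)) ⟩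
  (fix , free , sp) ∎
  where
  d : Dir
  d = fixDir h
  c t : Tree
  c = nodeAt d fix free
  t = graft sp c

_⊑_ : Word → Word → Set
x ⊑ w = x ≡ w ⊎ (x <ᵇ w) ≡ true

[]-⊑ : ∀ w → [] ⊑ w
[]-⊑ []      = inj₁ refl
[]-⊑ (_ ∷ _) = inj₂ refl

∷-mono-⊑ : ∀ d {x w} → x ⊑ w → (d ∷ x) ⊑ (d ∷ w)
∷-mono-⊑ d   (inj₁ refl) = inj₁ refl
∷-mono-⊑ one (inj₂ x<w)  = inj₂ x<w
∷-mono-⊑ two (inj₂ x<w)  = inj₂ x<w

<ᵇ-irrefl : ∀ x → (x <ᵇ x) ≡ false
<ᵇ-irrefl []        = refl
<ᵇ-irrefl (one ∷ x) = <ᵇ-irrefl x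
<ᵇ-irrefl (two ∷ x) = <ᵇ-irrefl x

<ᵇ-asym : ∀ x w → (x <ᵇ w) ≡ true → (w <ᵇ x) ≡ false
<ᵇ-asym []        (_ ∷ _)   _ = refl
<ᵇ-asym (one ∷ x) (one ∷ w) e = <ᵇ-asym x w e
<ᵇ-asym (one ∷ x) (two ∷ w) _ = refl
<ᵇ-asym (two ∷ x) (two ∷ w) e = <ᵇ-asym x w e

module _ (S : Tree → ℕ) where

  maxLex-selˡ : ∀ {a x} → x ⊑ a → maxLex S a x ≡ a
  maxLex-selˡ {a} (inj₁ refl) rewrite <ᵇ-irrefl a = refl
  maxLex-selˡ {a} {x} (inj₂ x<a) rewrite <ᵇ-asym x a x<a = refl

  maxLex-selʳ : ∀ {a x} → a ⊑ x → maxLex S a x ≡ x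
  maxLex-selʳ {a} (inj₁ refl) rewrite <ᵇ-irrefl a = refl
  maxLex-selʳ (inj₂ a<x) rewrite a<x = refl

  maxLex-⊑ : ∀ {a x w} → a ⊑ w → x ⊑ w → maxLex S a x ⊑ w
  maxLex-⊑ {a} {x} a⊑w x⊑w with a <ᵇ x
  ... | true  = x⊑w
  ... | false = a⊑w

  foldl-maxLex-≡ : ∀ {w} a L → a ⊑ w → All (_⊑ w) L → a ≡ w ⊎ w ∈ L → foldl (maxLex S) a L ≡ w
  foldl-maxLex-≡ a []      _   [] (inj₁ a≡w) = a≡w
  foldl-maxLex-≡ a []      _   [] (inj₂ ())
  foldl-maxLex-≡ {w} a (x ∷ L) a⊑w (x⊑w ∷ L⊑w) hit =
    foldl-maxLex-≡ (maxLex S a x) L (maxLex-⊑ a⊑w x⊑w) L⊑w (next hit)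
    where
    next : a ≡ w ⊎ w ∈ x ∷ L → maxLex S a x ≡ w ⊎ w ∈ L
    next (inj₁ refl)        = inj₁ (maxLex-selˡ x⊑w)
    next (inj₂ (here refl)) = inj₁ (maxLex-selʳ a⊑w)
    next (inj₂ (there w∈L)) = inj₂ w∈L

module HortonStrahler (S : Tree → ℕ) (S-isHS : ∀ t → IsHS t (S t)) where

  B⇒S≡ : ∀ {k t} → B k t → S t ≡ k
  B⇒S≡ {t = t} = isHS-unique (S-isHS t)

  S≡⇒B : ∀ {k t} → S t ≡ k → B k t
  S≡⇒B {t = t} e = subst (IsHS t) e (S-isHS t)

  S-leaf : S leaf ≡ 0
  S-leaf = B⇒S≡ isHS-leaf

  S-node : ∀ l r → S (node l r) ≡ nodeHS (S l) (S r)
  S-node l r = B⇒S≡ (isHS-node (S-isHS l) (S-isHS r))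

  S-≤ˡ : ∀ l r → S l ≤ S (node l r)
  S-≤ˡ l r = subst (S l ≤_) (sym (S-node l r)) (nodeHS-≥ˡ (S l) (S r))

  S-≤ʳ : ∀ l r → S r ≤ S (node l r)
  S-≤ʳ l r = subst (S r ≤_) (sym (S-node l r)) (nodeHS-≥ʳ (S l) (S r))

  S-θ-≤ : ∀ x t → S (θ x t) ≤ S t
  S-θ-≤ []        t          = ≤-refl
  S-θ-≤ (one ∷ x) (node l r) = ≤-trans (S-θ-≤ x l) (S-≤ˡ l r)
  S-θ-≤ (two ∷ x) (node l r) = ≤-trans (S-θ-≤ x r) (S-≤ʳ l r)
  S-θ-≤ (one ∷ _) leaf       = ≤-refl
  S-θ-≤ (two ∷ _) leaf       = ≤-refl

  reaches : ∀ x s t → S s ≤ S t → S (θ x s) ≡ S t → S s ≡ S t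
  reaches x s t s≤t e = ≤-antisym s≤t (subst (_≤ S s) e (S-θ-≤ x s))

  -- u(t), computed by descending into the right child whenever it keeps the number.
  spinePoint : Tree → Word
  spinePoint leaf = []
  spinePoint (node l r) with S r ≟ S (node l r) | S l ≟ S (node l r)
  ... | yes _ | _     = two ∷ spinePoint r
  ... | no _  | yes _ = one ∷ spinePoint l
  ... | no _  | no _  = []

  spinePoint-right : ∀ l r → S r ≡ S (node l r) → spinePoint (node l r) ≡ two ∷ spinePoint r
  spinePoint-right l r e with S r ≟ S (node l r)
  ... | yes _ = refl
  ... | no r≢ = ⊥-elim (r≢ e)

  spinePoint-left : ∀ l r → S r ≢ S (node l r) → S l ≡ S (node l r) → spinePoint (node l r) ≡ one ∷ spinePoint l
  spinePoint-left l r r≢ e with S r ≟ S (node l r) | S l ≟ S (node l r)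
  ... | yes r≡ | _     = ⊥-elim (r≢ r≡)
  ... | no _   | yes _ = refl
  ... | no _   | no l≢ = ⊥-elim (l≢ e)

  spinePoint-root : ∀ l r → S r ≢ S (node l r) → S l ≢ S (node l r) → spinePoint (node l r) ≡ []
  spinePoint-root l r r≢ l≢ with S r ≟ S (node l r) | S l ≟ S (node l r)
  ... | yes r≡ | _      = ⊥-elim (r≢ r≡)
  ... | no _   | yes l≡ = ⊥-elim (l≢ l≡)
  ... | no _   | no _   = refl

  spinePoint-vertex : ∀ t → spinePoint t ∈T t × S (θ (spinePoint t) t) ≡ S t
  spinePoint-vertex leaf = root , refl
  spinePoint-vertex (node l r) with S r ≟ S (node l r) | S l ≟ S (node l r)
  ... | yes r≡ | _     = let (u∈ , e) = spinePoint-vertex r in right u∈ , trans e r≡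
  ... | no _   | yes l≡ = let (u∈ , e) = spinePoint-vertex l in left u∈ , trans e l≡
  ... | no _   | no _  = root , refl

  spinePoint-greatest : ∀ t {x} → x ∈T t → S (θ x t) ≡ S t → x ⊑ spinePoint t
  spinePoint-greatest leaf root _ = inj₁ refl
  spinePoint-greatest (node l r) x∈ e with S r ≟ S (node l r) | S l ≟ S (node l r)
  spinePoint-greatest (node l r) root      _ | yes _  | _      = inj₂ refl
  spinePoint-greatest (node l r) (left _)  _ | yes _  | _      = inj₂ refl
  spinePoint-greatest (node l r) (right p) e | yes r≡ | _      = ∷-mono-⊑ two (spinePoint-greatest r p (trans e (sym r≡)))
  spinePoint-greatest (node l r) root      _ | no _   | yes _  = inj₂ refl
  spinePoint-greatest (node l r) (left p)  e | no _   | yes l≡ = ∷-mono-⊑ one (spinePoint-greatest l p (trans e (sym l≡)))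
  spinePoint-greatest (node l r) (right {u} _) e | no r≢ | _   = ⊥-elim (r≢ (reaches u r (node l r) (S-≤ʳ l r) e))
  spinePoint-greatest (node l r) root      _ | no _   | no _   = inj₁ refl
  spinePoint-greatest (node l r) (left {u} _) e | no _ | no l≢ = ⊥-elim (l≢ (reaches u l (node l r) (S-≤ˡ l r) e))

  uT≡spinePoint : ∀ t → uT S t ≡ spinePoint t
  uT≡spinePoint t =
    foldl-maxLex-≡ S [] _ ([]-⊑ _) (All.tabulate below)
      (inj₂ (∈-filter⁺ P? (vertices-complete t (proj₁ (spinePoint-vertex t))) (proj₂ (spinePoint-vertex t))))
    where
    P? : ∀ u → Dec (S (θ u t) ≡ S t)
    P? u = S (θ u t) ≟ S t
    below : ∀ {x} → x ∈ filter P? (vertices t) → x ⊑ spinePoint t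
    below x∈ = let (x∈t , e) = ∈-filter⁻ P? x∈ in spinePoint-greatest t (vertices-sound t x∈t) e

  -- The shape of the subtree at u(t).
  IsCore : ℕ → Tree → Set
  IsCore h leaf       = ⊥
  IsCore h (node L R) = S (node L R) ≡ h × S L < h × S R < h

  core-node : ∀ {h} c → IsCore h c → ∃₂ λ L R → c ≡ node L R
  core-node (node L R) _ = L , R , refl

  decompose : ∀ {h} → 1 ≤ h → ∀ t → S t ≡ h →
    IsCore h (θ (spinePoint t) t) × AllSpine h (spine t (spinePoint t))
  decompose h≥1 leaf e = ⊥-elim (<-irrefl (trans (sym S-leaf) e) h≥1)
  decompose {h} h≥1 (node l r) e with S r ≟ S (node l r) | S l ≟ S (node l r)
  ... | yes r≡ | _ =
    let (core , sp) = decompose h≥1 r (trans r≡ e)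
    in core , (S l , l-small , S-isHS l) ∷ sp
    where
    l-small : S l < ⌈ h /2⌉
    l-small = nodeHS-smallˡ⁻¹ (S l) h (begin
      nodeHS (S l) h           ≡⟨ cong (nodeHS (S l)) (sym (trans r≡ e)) ⟩
      nodeHS (S l) (S r)       ≡⟨ sym (S-node l r) ⟩
      S (node l r)             ≡⟨ e ⟩
      h                        ∎)
  ... | no r≢ | yes l≡ =
    let (core , sp) = decompose h≥1 l (trans l≡ e)
    in core , (S r , r-small , S-isHS r) ∷ sp
    where
    r-small : S r < ⌊ h /2⌋
    r-small = nodeHS-smallʳ⁻¹ h (S r)
      (begin
        nodeHS h (S r)         ≡⟨ cong (λ k → nodeHS k (S r)) (sym (trans l≡ e)) ⟩
        nodeHS (S l) (S r)     ≡⟨ sym (S-node l r) ⟩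
        S (node l r)           ≡⟨ e ⟩
        h                      ∎)
      (subst (S r <_) e (≤∧≢⇒< (S-≤ʳ l r) r≢))
  ... | no r≢ | no l≢ =
    (e , subst (S l <_) e (≤∧≢⇒< (S-≤ˡ l r) l≢) , subst (S r <_) e (≤∧≢⇒< (S-≤ʳ l r) r≢)) , []

  compose : ∀ {h c sp} → IsCore h c → AllSpine h sp → S (graft sp c) ≡ h × spinePoint (graft sp c) ≡ dirs sp
  compose {c = node L R} (e , L< , R<) [] =
    e , spinePoint-root L R (λ R≡ → <-irrefl (trans R≡ e) R<) (λ L≡ → <-irrefl (trans L≡ e) L<)
  compose {h} {c} {(one , s) ∷ sp} core ((k , k-small , Bk) ∷ ok) =
    St≡h , trans (spinePoint-right s t (trans St′≡h (sym St≡h))) (cong (two ∷_) u≡)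
    where
    t : Tree
    t = graft sp c
    St′≡h : S t ≡ h
    St′≡h = proj₁ (compose core ok)
    u≡ : spinePoint t ≡ dirs sp
    u≡ = proj₂ (compose core ok)
    St≡h : S (node s t) ≡ h
    St≡h = begin
      S (node s t)         ≡⟨ S-node s t ⟩
      nodeHS (S s) (S t)   ≡⟨ cong₂ nodeHS (B⇒S≡ Bk) St′≡h ⟩
      nodeHS k h           ≡⟨ nodeHS-smallˡ k h k-small ⟩
      h                    ∎
  compose {h} {c} {(two , s) ∷ sp} core ((k , k-small , Bk) ∷ ok) =
    St≡h , trans (spinePoint-left t s s≢ (trans St′≡h (sym St≡h))) (cong (one ∷_) u≡)
    where
    t : Tree
    t = graft sp c
    St′≡h : S t ≡ h
    St′≡h = proj₁ (compose core ok)
    u≡ : spinePoint t ≡ dirs sp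
    u≡ = proj₂ (compose core ok)
    St≡h : S (node t s) ≡ h
    St≡h = begin
      S (node t s)         ≡⟨ S-node t s ⟩
      nodeHS (S t) (S s)   ≡⟨ cong₂ nodeHS St′≡h (B⇒S≡ Bk) ⟩
      nodeHS h k           ≡⟨ nodeHS-smallʳ h k k-small ⟩
      h                    ∎
    s≢ : S s ≢ S (node t s)
    s≢ s≡ = <-irrefl (trans (trans (sym (B⇒S≡ Bk)) s≡) St≡h) (≤-trans k-small (⌊n/2⌋≤n h))

  core⇒fix-free : ∀ {h} c → IsCore h c →
    B (⌈ h /2⌉ ∸ 1) (θ [ fixDir h ] c) × ∃ λ k → ⌊ h /2⌋ ≤ k × k < h × B k (θ [ flip (fixDir h) ] c)
  core⇒fix-free (node L R) (e , L<h , R<h)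
    with nodeHS-children< (S L) (S R) _ (trans (sym (S-node L R)) e) L<h R<h
  ... | inj₁ (refl , L≤R)
    rewrite fixDir-odd (S L) | proj₁ (odd-halves (S L)) | proj₂ (odd-halves (S L)) =
      S-isHS L , S R , L≤R , R<h , S-isHS R
  ... | inj₂ (refl , R<L)
    rewrite fixDir-even (S R) | proj₁ (even-halves (S R)) | proj₂ (even-halves (S R)) =
      S-isHS R , S L , R<L , L<h , S-isHS L

  fix-free⇒core : ∀ {h fix free} → 1 ≤ h → B (⌈ h /2⌉ ∸ 1) fix →
    (∃ λ k → ⌊ h /2⌋ ≤ k × k < h × B k free) → IsCore h (nodeAt (fixDir h) fix free)
  fix-free⇒core {suc n} {fix} {free} _ Bfix (k , k≥ , k< , Bk) with oddOrEven n
  ... | odd m rewrite fixDir-odd m | proj₁ (odd-halves m) | proj₂ (odd-halves m) =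
    trans (S-node fix free) (trans (cong₂ nodeHS Sfix (B⇒S≡ Bk)) (nodeHS-odd m k k≥ k<)) ,
    subst (_< suc (m + m)) (sym Sfix) (s≤s (m≤m+n m m)) ,
    subst (_< suc (m + m)) (sym (B⇒S≡ Bk)) k<
    where
    Sfix : S fix ≡ m
    Sfix = B⇒S≡ Bfix
  ... | even m rewrite fixDir-even m | proj₁ (even-halves m) | proj₂ (even-halves m) =
    trans (S-node free fix) (trans (cong₂ nodeHS (B⇒S≡ Bk) Sfix) (nodeHS-even m k k≥ k<)) ,
    subst (_< suc (suc (m + m))) (sym (B⇒S≡ Bk)) k< ,
    subst (_< suc (suc (m + m))) (sym Sfix) (s≤s (m≤n⇒m≤1+n (m≤m+n m m)))
    where
    Sfix : S fix ≡ m
    Sfix = B⇒S≡ Bfix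

  module _ {h} (h≥1 : 1 ≤ h) where

    G-into-B′ : ∀ t → B h t → B′ h (G S t)
    G-into-B′ t Bt with decompose h≥1 t (B⇒S≡ Bt)
    ... | core , spine-ok =
      let (fix-ok , free-ok) = core⇒fix-free _ core
      in subst (B′ h) (sym (G-unfold S t (B⇒S≡ Bt) (uT≡spinePoint t))) (fix-ok , free-ok , spine-ok)

    rebuild-inverseˡ : ∀ t → B h t → rebuild h (G S t) ≡ t
    rebuild-inverseˡ t Bt with core-node _ (proj₁ (decompose h≥1 t (B⇒S≡ Bt)))
    ... | _ , _ , c≡ = rebuild-G S t (B⇒S≡ Bt) (uT≡spinePoint t) (proj₁ (spinePoint-vertex t)) c≡

    rebuild-inverseʳ : ∀ y → B′ h y → B h (rebuild h y) × G S (rebuild h y) ≡ y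
    rebuild-inverseʳ (fix , free , sp) (Bfix , free-ok , sp-ok)
      with compose (fix-free⇒core h≥1 Bfix free-ok) sp-ok
    ... | St≡h , u≡ =
      S≡⇒B St≡h , G-rebuild S h fix free sp St≡h (trans (uT≡spinePoint (rebuild h (fix , free , sp))) u≡)

lemma2p3 : (S : Tree → ℕ) → (∀ t → IsHS t (S t)) → (h : ℕ) → h ≥ 1 →
    (∀ t → B h t → B′ h (G S t))
    × (∀ t t′ → B h t → B h t′ → G S t ≡ G S t′ → t ≡ t′)
    × (∀ y → B′ h y → ∃ λ t → B h t × G S t ≡ y)
lemma2p3 S S-isHS h h≥1 = G-into-B′ h≥1 , injective , λ y y∈ → rebuild h y , rebuild-inverseʳ h≥1 y y∈
  where
  open HortonStrahler S S-isHS
  injective : ∀ t t′ → B h t → B h t′ → G S t ≡ G S t′ → t ≡ t′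
  injective t t′ Bt Bt′ G≡ = begin
    t                   ≡⟨ sym (rebuild-inverseˡ h≥1 t Bt) ⟩
    rebuild h (G S t)   ≡⟨ cong (rebuild h) G≡ ⟩
    rebuild h (G S t′)  ≡⟨ rebuild-inverseˡ h≥1 t′ Bt′ ⟩
    t′                  ∎
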